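{- Let $q=p^h$ with $p$ an odd prime, $p\neq 3$, and write $p=3k\pm1$ with $k$ a positive integer. Then there exists a good set $\Lambda\subseteq\mathbb{F}_q\setminus\{0\}$ of size $kq/p$.
   Context: A set $\Lambda\subseteq\mathbb{F}_q\setminus\{0\}$ is called good if $\lambda_1\lambda_2+\lambda_2\lambda_3+\lambda_1\lambda_3\neq 0$ for all $\lambda_1,\lambda_2,\lambda_3\in\Lambda$ (not necessarily distinct). -}

module Defs where

open import Level using (0ℓ)
open import Data.Nat using (ℕ)
open import Data.Fin using (Fin)
open import Data.Fin.Subset using (Subset; _∈_)
open import Data.Product using (∃)
open import Relation.Nullary using (¬_)
open import Relation.Binary.PropositionalEquality using (_≡_; _≢_)
open import Algebra.Structures using (IsCommutativeRing)

-- A field structure on the n-element set Fin n (equality is propositional).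
-- Every finite field of order q is isomorphic to one of these with n = q.
record FieldOn (n : ℕ) : Set where
  infixl 6 _+_
  infixl 7 _*_
  field
    _+_ _*_ : Fin n → Fin n → Fin n
    -_      : Fin n → Fin n
    0# 1#   : Fin n
    isCommutativeRing : IsCommutativeRing _≡_ _+_ _*_ -_ 0# 1#
    0≢1     : 0# ≢ 1#
    inverse : ∀ x → x ≢ 0# → ∃ λ y → x * y ≡ 1#

NonZeroSubset : ∀ {n} → FieldOn n → Subset n → Set
NonZeroSubset F Λ = ∀ x → x ∈ Λ → x ≢ FieldOn.0# F

Good : ∀ {n} → FieldOn n → Subset n → Set
Good F Λ = ∀ a b c → a ∈ Λ → b ∈ Λ → c ∈ Λ →
           (a * b) + (b * c) + (a * c) ≢ 0#
  where open FieldOn F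

-- A field F of order p^h has characteristic p, and a basis of (F, +) over F_p built greedily gives
-- an additive coordinate φ : F → F_p each of whose fibres has p^(h-1) elements.  Since
-- λ₁λ₂ + λ₂λ₃ + λ₁λ₃ = λ₁λ₂λ₃ (λ₁⁻¹ + λ₂⁻¹ + λ₃⁻¹), the set Λ = {λ ≠ 0 : φ(λ⁻¹) ∈ S} is good as soon
-- as 0 ∉ S ⊆ F_p and no three elements of S sum to 0.  For p = 3k + 1 take S = {1, …, k}, whose
-- triple sums lie in [3, 3k]; for p = 3k - 1 take S = {k, …, 2k - 1}, whose triple sums lie in
-- [p + 1, 2p - 1].  Then |Λ| = |S| p^(h-1) = k p^(h-1).
module Submission where

open import Defs
open import Data.Nat using (ℕ; _+_; _*_; _^_; _∸_; _≤_)
open import Data.Nat.Primality using (Prime)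
open import Data.Nat.Divisibility using (_∣_)
open import Data.Fin.Subset using (Subset; ∣_∣)
open import Data.Product using (Σ; _×_)
open import Data.Sum using (_⊎_)
open import Relation.Nullary using (¬_)
open import Relation.Binary.PropositionalEquality using (_≡_; _≢_)

open import Level using (0ℓ)
open import Function using (_∘_)
open import Function.Definitions using (Injective)
open import Data.Bool using (Bool; true; false; _∧_)
open import Data.Product using (_,_; proj₁; proj₂; ∃-syntax)
open import Data.Sum using (inj₁; inj₂)
open import Data.Nat as ℕ using (zero; suc; _<_; z≤n; s≤s; NonZero; _%_; _/_)
import Data.Nat.Properties as ℕ
import Data.Nat.DivMod as ℕ
open import Data.Nat.Tactic.RingSolver using (solve-∀)
open import Data.Nat.Divisibility using (m∣m*n; ∣1⇒≡1)
open import Data.Nat.Primality using (prime⇒nonZero; prime⇒nonTrivial; euclidsLemma; prime⇒irreducible)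
open import Data.Nat.Primality.Factorisation using (factorise; PrimeFactorisation)
import Data.Nat.Coprimality as Coprimality
open import Data.Nat.GCD using (module Bézout)
open import Data.Nat.ListAction using (product)
open import Data.List using ([]; _∷_)
open import Data.List.Relation.Unary.All using (All; []; _∷_)
open import Data.Fin as Fin using (Fin; toℕ)
import Data.Fin.Properties as Fin
open import Data.Fin.Permutation using (permutation)
open import Data.Fin.Subset using (_∈_)
open import Data.Vec using (Vec; []; _∷_; tabulate)
import Data.Vec.Properties as Vec
open import Relation.Nullary using (Dec; yes; no; contradiction)
open import Relation.Nullary.Decidable using (does; proof; _×-dec_)
open import Relation.Nullary.Reflects using (Reflects; invert)
import Relation.Unary as U
open import Relation.Binary.Definitions using (tri<; tri≈; tri>)
open import Relation.Binary.PropositionalEquality using (refl; sym; trans; cong; cong₂; subst; module ≡-Reasoning)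
open import Algebra.Bundles using (CommutativeRing)
import Algebra.Solver.CommutativeMonoid as MonoidSolver
import Algebra.Properties.AbelianGroup as AbelianGroupProperties
import Algebra.Properties.CommutativeSemigroup as CommutativeSemigroupProperties
import Algebra.Properties.Semiring.Mult as SemiringMult
open import Algebra.Properties.CommutativeMonoid.Sum ℕ.+-0-commutativeMonoid using (sum; sum-permute; sum-cong-≗)
open import Algebra.Properties.Semiring.Sum ℕ.+-*-semiring using (*-distribˡ-sum)

prime⇒1<p : ∀ {p} → Prime p → 1 < p
prime⇒1<p {p} p-prime = ℕ.nonTrivial⇒n>1 p {{prime⇒nonTrivial p-prime}}

n<m^n : ∀ {m} → 1 < m → ∀ n → n < m ^ n
n<m^n 1<m zero = s≤s z≤n
n<m^n {m} 1<m (suc n) = ℕ.<-≤-trans (s≤s (n<m^n 1<m n)) (ℕ.^-monoʳ-< m 1<m (ℕ.n<1+n n))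

prime∣m^n⇒prime∣m : ∀ {p m} n → Prime p → p ∣ m ^ n → p ∣ m
prime∣m^n⇒prime∣m zero p-prime p∣1 = contradiction (∣1⇒≡1 p∣1) (ℕ.nonTrivial⇒≢1 {{prime⇒nonTrivial p-prime}})
prime∣m^n⇒prime∣m {m = m} (suc n) p-prime p∣m*m^n with euclidsLemma m (m ^ n) p-prime p∣m*m^n
... | inj₁ p∣m = p∣m
... | inj₂ p∣m^n = prime∣m^n⇒prime∣m n p-prime p∣m^n

^-injectiveʳ : ∀ {m} → 1 < m → ∀ {a b} → m ^ a ≡ m ^ b → a ≡ b
^-injectiveʳ {m} 1<m {a} {b} m^a≡m^b with ℕ.<-cmp a b
... | tri< a<b _ _ = contradiction m^a≡m^b (ℕ.<⇒≢ (ℕ.^-monoʳ-< m 1<m a<b))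
... | tri≈ _ a≡b _ = a≡b
... | tri> _ _ a>b = contradiction (sym m^a≡m^b) (ℕ.<⇒≢ (ℕ.^-monoʳ-< m 1<m a>b))

prime-power-unique : ∀ {d p m h} → Prime d → Prime p → 1 ≤ h → d ^ m ≡ p ^ h → d ≡ p × m ≡ h
prime-power-unique {d} {p} {m} {suc h} d-prime p-prime _ d^m≡p^h with prime⇒irreducible d-prime p∣d
  where
  p∣d : p ∣ d
  p∣d = prime∣m^n⇒prime∣m m p-prime (subst (p ∣_) (sym d^m≡p^h) (m∣m*n (p ^ h)))
... | inj₁ p≡1 = contradiction p≡1 (ℕ.nonTrivial⇒≢1 {{prime⇒nonTrivial p-prime}})
... | inj₂ refl = refl , ^-injectiveʳ (prime⇒1<p p-prime) d^m≡p^h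

indicator : Bool → ℕ
indicator true = 1
indicator false = 0

∣tabulate∣≡sum : ∀ {m} (f : Fin m → Bool) → ∣ tabulate f ∣ ≡ sum (λ i → indicator (f i))
∣tabulate∣≡sum {zero} f = refl
∣tabulate∣≡sum {suc m} f with f Fin.zero
... | true = cong suc (∣tabulate∣≡sum (f ∘ Fin.suc))
... | false = ∣tabulate∣≡sum (f ∘ Fin.suc)

sum-↑ : ∀ a b (f : Fin (a + b) → ℕ) → sum f ≡ sum (λ i → f (i Fin.↑ˡ b)) + sum (λ i → f (a Fin.↑ʳ i))
sum-↑ zero b f = refl
sum-↑ (suc a) b f = trans (cong (f Fin.zero +_) (sum-↑ a b (f ∘ Fin.suc))) (sym (ℕ.+-assoc (f Fin.zero) _ _))

sum-combine : ∀ a b (f : Fin (a * b) → ℕ) → sum f ≡ sum {a} (λ c → sum {b} (λ r → f (Fin.combine c r)))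
sum-combine zero b f = refl
sum-combine (suc a) b f = trans (sum-↑ b (a * b) f) (cong (sum (λ r → f (Fin.combine {suc a} Fin.zero r)) +_) (sum-combine a b (λ i → f (b Fin.↑ʳ i))))

sum-const : ∀ b x → sum {b} (λ _ → x) ≡ b * x
sum-const zero x = refl
sum-const (suc b) x = cong (x +_) (sum-const b x)

[m%d+n]%d≡[m+n]%d : ∀ m n d .{{_ : NonZero d}} → (m % d + n) % d ≡ (m + n) % d
[m%d+n]%d≡[m+n]%d m n d = begin
  (m % d + n) % d             ≡⟨ ℕ.%-distribˡ-+ (m % d) n d ⟩
  (m % d % d + n % d) % d     ≡⟨ cong (λ k → (k + n % d) % d) (ℕ.m%n%n≡m%n m d) ⟩
  (m % d + n % d) % d         ≡⟨ ℕ.%-distribˡ-+ m n d ⟨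
  (m + n) % d                 ∎
  where open ≡-Reasoning

ThreeSumFree : (d : ℕ) .{{_ : NonZero d}} → (ℕ → Set) → Set
ThreeSumFree d S = ∀ {a b c} → S a → S b → S c → (a + b + c) % d ≢ 0

%≢0-between : ∀ {p s} q .{{_ : NonZero p}} → q * p < s → s < suc q * p → s % p ≢ 0
%≢0-between {p} {s} q qp<s s<[1+q]p s%p≡0 =
  ℕ.<⇒≱ (ℕ.*-cancelʳ-< p (s / p) (suc q) (subst (_< suc q * p) s≡[s/p]p s<[1+q]p))
        (ℕ.*-cancelʳ-< p q (s / p) (subst (q * p <_) s≡[s/p]p qp<s))
  where
  s≡[s/p]p : s ≡ s / p * p
  s≡[s/p]p = trans (ℕ.m≡m%n+[m/n]*n s p) (cong (_+ s / p * p) s%p≡0)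

InInterval : ℕ → ℕ → ℕ → Set
InInterval lo hi c = lo ≤ c × c < hi

InInterval? : ∀ lo hi → U.Decidable (InInterval lo hi)
InInterval? lo hi c = lo ℕ.≤? c ×-dec c ℕ.<? hi

countBelow : ∀ {S : ℕ → Set} → U.Decidable S → ℕ → ℕ
countBelow S? N = sum {N} (λ c → indicator (does (S? (toℕ c))))

count-initial-interval : ∀ {len N} → len ≤ N → countBelow (InInterval? 0 len) N ≡ len
count-initial-interval {zero} {zero} _ = refl
count-initial-interval {zero} {suc N} _ = count-initial-interval {zero} {N} z≤n
count-initial-interval {suc len} {suc N} (s≤s len≤N) = cong suc (count-initial-interval len≤N)

<ᵇ-suc : ∀ m n → (m ℕ.<ᵇ suc n) ≡ (m ℕ.≤ᵇ n)
<ᵇ-suc zero n = refl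
<ᵇ-suc (suc m) n = refl

-- Dropping the residue 0 and renumbering c + 1 as c turns [lo + 1, lo + 1 + len) into [lo, lo + len).
count-interval : ∀ lo len {N} → lo + len ≤ N → countBelow (InInterval? lo (lo + len)) N ≡ len
count-interval zero len le = count-initial-interval le
count-interval (suc lo) len {suc N} (s≤s le) =
  trans (sum-cong-≗ {N} (λ c → cong (λ b → indicator (b ∧ (toℕ c ℕ.<ᵇ lo + len))) (<ᵇ-suc lo (toℕ c))))
        (count-interval lo len le)

+-mono₃-≤ : ∀ {a b c a' b' c'} → a ≤ a' → b ≤ b' → c ≤ c' → a + b + c ≤ a' + b' + c'
+-mono₃-≤ a≤a' b≤b' c≤c' = ℕ.+-mono-≤ (ℕ.+-mono-≤ a≤a' b≤b') c≤c'

k+k+k≡3k : ∀ k → k + k + k ≡ 3 * k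
k+k+k≡3k = solve-∀

[1…k]-threeSumFree : ∀ {p k} .{{_ : NonZero p}} → p ≡ 3 * k + 1 → ThreeSumFree p (InInterval 1 (suc k))
[1…k]-threeSumFree {p} {k} refl {a} {b} {c} (1≤a , a<1+k) (_ , b<1+k) (_ , c<1+k) = %≢0-between 0 0<s s<p
  where
  open ℕ.≤-Reasoning
  0<s : 0 < a + b + c
  0<s = ℕ.≤-trans 1≤a (ℕ.≤-trans (ℕ.m≤m+n a b) (ℕ.m≤m+n (a + b) c))
  s<p : a + b + c < 1 * (3 * k + 1)
  s<p = begin-strict
    a + b + c         ≤⟨ +-mono₃-≤ (ℕ.s≤s⁻¹ a<1+k) (ℕ.s≤s⁻¹ b<1+k) (ℕ.s≤s⁻¹ c<1+k) ⟩
    k + k + k         ≡⟨ k+k+k≡3k k ⟩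
    3 * k             <⟨ ℕ.m<m+n (3 * k) (s≤s z≤n) ⟩
    3 * k + 1         ≡⟨ ℕ.*-identityˡ _ ⟨
    1 * (3 * k + 1)   ∎

[k…2k-1]-threeSumFree : ∀ {p k} .{{_ : NonZero p}} → p + 1 ≡ 3 * k → ThreeSumFree p (InInterval k (k + k))
[k…2k-1]-threeSumFree {p} {k} p+1≡3k {a} {b} {c} (k≤a , a<2k) (k≤b , b<2k) (k≤c , c<2k) = %≢0-between 1 p<s s<2p
  where
  open ℕ.≤-Reasoning
  p<s : 1 * p < a + b + c
  p<s = begin-strict
    1 * p          ≡⟨ ℕ.*-identityˡ p ⟩
    p              <⟨ ℕ.n<1+n p ⟩
    suc p          ≡⟨ ℕ.+-comm 1 p ⟩
    p + 1          ≡⟨ p+1≡3k ⟩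
    3 * k          ≡⟨ k+k+k≡3k k ⟨
    k + k + k      ≤⟨ +-mono₃-≤ k≤a k≤b k≤c ⟩
    a + b + c      ∎
  2+[1+s]≤2+2p : 2 + suc (a + b + c) ≤ 2 + 2 * p
  2+[1+s]≤2+2p = begin
    2 + suc (a + b + c)            ≡⟨ regroup a b c ⟩
    suc a + suc b + suc c          ≤⟨ +-mono₃-≤ a<2k b<2k c<2k ⟩
    (k + k) + (k + k) + (k + k)    ≡⟨ [k+k]+[k+k]+[k+k]≡2*[3k] k ⟩
    2 * (3 * k)                    ≡⟨ cong (2 *_) p+1≡3k ⟨
    2 * (p + 1)                    ≡⟨ 2*[p+1]≡2+2p p ⟩
    2 + 2 * p                      ∎
    where
    regroup : ∀ a b c → 2 + suc (a + b + c) ≡ suc a + suc b + suc c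
    regroup = solve-∀
    [k+k]+[k+k]+[k+k]≡2*[3k] : ∀ k → (k + k) + (k + k) + (k + k) ≡ 2 * (3 * k)
    [k+k]+[k+k]+[k+k]≡2*[3k] = solve-∀
    2*[p+1]≡2+2p : ∀ p → 2 * (p + 1) ≡ 2 + 2 * p
    2*[p+1]≡2+2p = solve-∀
  s<2p : a + b + c < 2 * p
  s<2p = ℕ.+-cancelˡ-≤ 2 _ _ 2+[1+s]≤2+2p

threeSumFree-residues : ∀ {p k} .{{_ : NonZero p}} → 1 ≤ k → (p ≡ 3 * k + 1 ⊎ p + 1 ≡ 3 * k) →
                        ∃[ S ] Σ (U.Decidable S) λ S? → ¬ S 0 × ThreeSumFree p S × countBelow S? p ≡ k
threeSumFree-residues {p} {k} _ (inj₁ p≡3k+1) =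
  InInterval 1 (suc k) , InInterval? 1 (suc k) , (λ ()) , [1…k]-threeSumFree p≡3k+1 , count-interval 1 k 1+k≤p
  where
  1+k≤p : suc k ≤ p
  1+k≤p = subst (suc k ≤_) (trans (ℕ.+-comm 1 (3 * k)) (sym p≡3k+1)) (s≤s (ℕ.m≤m+n k (2 * k)))
threeSumFree-residues {p} {k} 1≤k (inj₂ p+1≡3k) =
  InInterval k (k + k) , InInterval? k (k + k) , (λ (k≤0 , _) → ℕ.<⇒≱ 1≤k k≤0) , [k…2k-1]-threeSumFree p+1≡3k ,
  count-interval k k 2k≤p
  where
  2k≤p : k + k ≤ p
  2k≤p = ℕ.+-cancelʳ-≤ 1 (k + k) p (subst (k + k + 1 ≤_) (trans (k+k+k≡3k k) (sym p+1≡3k)) (ℕ.+-monoʳ-≤ (k + k) 1≤k))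

module _ {r ℓ} (R : CommutativeRing r ℓ) where
  open CommutativeRing R
    using (_≈_; 1#; setoid; *-commutativeMonoid; +-cong; +-congʳ; *-cong; *-congˡ; *-congʳ; *-identityˡ; distribʳ)
    renaming (_+_ to _⊕_; _*_ to _⊛_; refl to ≈-refl; trans to ≈-trans)
  open MonoidSolver *-commutativeMonoid using (solve; _⊜_) renaming (_⊕_ to _⊗_)
  open import Relation.Binary.Reasoning.Setoid setoid

  unit-cancel : ∀ {a a' b b'} c → a ⊛ a' ≈ 1# → b ⊛ b' ≈ 1# → (a ⊛ b) ⊛ ((a' ⊛ b') ⊛ c) ≈ c
  unit-cancel {a} {a'} {b} {b'} c aa'≈1 bb'≈1 = begin
    (a ⊛ b) ⊛ ((a' ⊛ b') ⊛ c)   ≈⟨ solve 5 (λ a b a' b' c → (a ⊗ b) ⊗ ((a' ⊗ b') ⊗ c) ⊜ ((a ⊗ a') ⊗ (b ⊗ b')) ⊗ c) ≈-refl a b a' b' c ⟩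
    ((a ⊛ a') ⊛ (b ⊛ b')) ⊛ c   ≈⟨ *-congʳ (*-cong aa'≈1 bb'≈1) ⟩
    (1# ⊛ 1#) ⊛ c               ≈⟨ *-congʳ (*-identityˡ 1#) ⟩
    1# ⊛ c                      ≈⟨ *-identityˡ c ⟩
    c                           ∎

  reciprocal-sum : ∀ {a a' b b' c c'} → a ⊛ a' ≈ 1# → b ⊛ b' ≈ 1# → c ⊛ c' ≈ 1# →
                   (a ⊛ b ⊕ b ⊛ c ⊕ a ⊛ c) ⊛ ((a' ⊛ b') ⊛ c') ≈ c' ⊕ a' ⊕ b'
  reciprocal-sum {a} {a'} {b} {b'} {c} {c'} aa'≈1 bb'≈1 cc'≈1 = begin
    (a ⊛ b ⊕ b ⊛ c ⊕ a ⊛ c) ⊛ P               ≈⟨ distribʳ P _ _ ⟩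
    (a ⊛ b ⊕ b ⊛ c) ⊛ P ⊕ (a ⊛ c) ⊛ P         ≈⟨ +-congʳ (distribʳ P _ _) ⟩
    (a ⊛ b) ⊛ P ⊕ (b ⊛ c) ⊛ P ⊕ (a ⊛ c) ⊛ P   ≈⟨ +-cong (+-cong (unit-cancel c' aa'≈1 bb'≈1) bc) ac ⟩
    c' ⊕ a' ⊕ b'                              ∎
    where
    P = (a' ⊛ b') ⊛ c'
    bc : (b ⊛ c) ⊛ P ≈ a'
    bc = ≈-trans (*-congˡ (solve 3 (λ a' b' c' → (a' ⊗ b') ⊗ c' ⊜ (b' ⊗ c') ⊗ a') ≈-refl a' b' c')) (unit-cancel a' bb'≈1 cc'≈1)
    ac : (a ⊛ c) ⊛ P ≈ b'
    ac = ≈-trans (*-congˡ (solve 3 (λ a' b' c' → (a' ⊗ b') ⊗ c' ⊜ (a' ⊗ c') ⊗ b') ≈-refl a' b' c')) (unit-cancel b' aa'≈1 cc'≈1)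

commutativeRing : ∀ {n} → FieldOn n → CommutativeRing 0ℓ 0ℓ
commutativeRing F = record { isCommutativeRing = FieldOn.isCommutativeRing F }

module FiniteField {n} (F : FieldOn n) where
  open FieldOn F using (0#; 1#; 0≢1; inverse) renaming (_+_ to _⊕_; _*_ to _⊛_; -_ to ⊝_)
  open CommutativeRing (commutativeRing F)
    using (+-identityˡ; +-identityʳ; *-identityˡ; *-identityʳ; *-comm; *-assoc; zeroˡ; zeroʳ; +-abelianGroup; semiring; +-commutativeSemigroup)
  open AbelianGroupProperties +-abelianGroup using (∙-cancelˡ; inverseʳ-unique; x≈z//y) renaming (⁻¹-involutive to -‿involutive)
  open SemiringMult semiring using (×-homo-+; ×-assocˡ; ×-assoc-*; ×1-homo-*) renaming (_×_ to _·_)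
  open CommutativeSemigroupProperties +-commutativeSemigroup using (interchange; xy∙z≈y∙xz)
  open ≡-Reasoning

  x*y≡0⇒y≡0 : ∀ {x y} → x ⊛ y ≡ 0# → x ≢ 0# → y ≡ 0#
  x*y≡0⇒y≡0 {x} {y} xy≡0 x≢0 with inverse x x≢0
  ... | x' , xx'≡1 = begin
    y               ≡⟨ sym (*-identityˡ y) ⟩
    1# ⊛ y          ≡⟨ cong (_⊛ y) (trans (sym xx'≡1) (*-comm x x')) ⟩
    (x' ⊛ x) ⊛ y    ≡⟨ *-assoc x' x y ⟩
    x' ⊛ (x ⊛ y)    ≡⟨ cong (x' ⊛_) xy≡0 ⟩
    x' ⊛ 0#         ≡⟨ zeroʳ x' ⟩
    0#              ∎

  ∃nonZero·1≡0 : ∃[ N ] NonZero N × N · 1# ≡ 0#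
  ∃nonZero·1≡0 with Fin.pigeonhole (ℕ.n<1+n n) (λ (i : Fin (suc n)) → toℕ i · 1#)
  ... | i , j , i<j , i·1≡j·1 = toℕ j ∸ toℕ i , ℕ.>-nonZero (ℕ.m<n⇒0<n∸m i<j) , ∙-cancelˡ (toℕ i · 1#) _ _ split
    where
    split : toℕ i · 1# ⊕ (toℕ j ∸ toℕ i) · 1# ≡ toℕ i · 1# ⊕ 0#
    split = begin
      toℕ i · 1# ⊕ (toℕ j ∸ toℕ i) · 1#   ≡⟨ sym (×-homo-+ 1# (toℕ i) _) ⟩
      (toℕ i + (toℕ j ∸ toℕ i)) · 1#      ≡⟨ cong (_· 1#) (ℕ.m+[n∸m]≡n (ℕ.<⇒≤ i<j)) ⟩
      toℕ j · 1#                          ≡⟨ sym i·1≡j·1 ⟩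
      toℕ i · 1#                          ≡⟨ sym (+-identityʳ _) ⟩
      toℕ i · 1# ⊕ 0#                     ∎

  product·1≡0⇒prime·1≡0 : ∀ {ps} → All Prime ps → product ps · 1# ≡ 0# → ∃[ d ] Prime d × d · 1# ≡ 0#
  product·1≡0⇒prime·1≡0 [] 1≡0 = contradiction (sym (trans (sym (+-identityʳ 1#)) 1≡0)) 0≢1
  product·1≡0⇒prime·1≡0 {d ∷ ps} (d-prime ∷ ps-prime) d·ps≡0 with (d · 1#) Fin.≟ 0#
  ... | yes d·1≡0 = d , d-prime , d·1≡0
  ... | no d·1≢0 = product·1≡0⇒prime·1≡0 ps-prime (x*y≡0⇒y≡0 (trans (sym (×1-homo-* d (product ps))) d·ps≡0) d·1≢0)

  primeCharacteristic : ∃[ d ] Prime d × d · 1# ≡ 0#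
  primeCharacteristic with ∃nonZero·1≡0
  ... | N , N≢0 , N·1≡0 = product·1≡0⇒prime·1≡0 factorsPrime (subst (λ m → m · 1# ≡ 0#) isFactorisation N·1≡0)
    where open PrimeFactorisation (factorise N {{N≢0}})

  infix 8 _⁻¹
  _⁻¹ : Fin n → Fin n
  x ⁻¹ with x Fin.≟ 0#
  ... | yes _ = 0#
  ... | no x≢0 = proj₁ (inverse x x≢0)

  0⁻¹≡0 : 0# ⁻¹ ≡ 0#
  0⁻¹≡0 with 0# Fin.≟ 0#
  ... | yes _ = refl
  ... | no 0≢0 = contradiction refl 0≢0

  x*x⁻¹≡1 : ∀ {x} → x ≢ 0# → x ⊛ x ⁻¹ ≡ 1#
  x*x⁻¹≡1 {x} x≢0 with x Fin.≟ 0#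
  ... | yes x≡0 = contradiction x≡0 x≢0
  ... | no x≢0 = proj₂ (inverse x x≢0)

  x⁻¹≢0 : ∀ {x} → x ≢ 0# → x ⁻¹ ≢ 0#
  x⁻¹≢0 {x} x≢0 x⁻¹≡0 = 0≢1 (begin
    0#          ≡⟨ sym (zeroʳ x) ⟩
    x ⊛ 0#      ≡⟨ cong (x ⊛_) (sym x⁻¹≡0) ⟩
    x ⊛ x ⁻¹    ≡⟨ x*x⁻¹≡1 x≢0 ⟩
    1#          ∎)

  inverse-unique : ∀ {x y z} → x ⊛ y ≡ 1# → x ⊛ z ≡ 1# → y ≡ z
  inverse-unique {x} {y} {z} xy≡1 xz≡1 = begin
    y              ≡⟨ sym (*-identityˡ y) ⟩
    1# ⊛ y         ≡⟨ cong (_⊛ y) (trans (sym xz≡1) (*-comm x z)) ⟩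
    (z ⊛ x) ⊛ y    ≡⟨ *-assoc z x y ⟩
    z ⊛ (x ⊛ y)    ≡⟨ cong (z ⊛_) xy≡1 ⟩
    z ⊛ 1#         ≡⟨ *-identityʳ z ⟩
    z              ∎

  ⁻¹-involutive : ∀ x → x ⁻¹ ⁻¹ ≡ x
  ⁻¹-involutive x = by-cases (x Fin.≟ 0#)
    where
    by-cases : Dec (x ≡ 0#) → x ⁻¹ ⁻¹ ≡ x
    by-cases (yes refl) = trans (cong _⁻¹ 0⁻¹≡0) 0⁻¹≡0
    by-cases (no x≢0) = inverse-unique (x*x⁻¹≡1 (x⁻¹≢0 x≢0)) (trans (*-comm _ x) (x*x⁻¹≡1 x≢0))

  sum-∘⁻¹ : ∀ (f : Fin n → ℕ) → sum (λ x → f (x ⁻¹)) ≡ sum f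
  sum-∘⁻¹ f = sym (sum-permute f (permutation _⁻¹ _⁻¹ ⁻¹-involutive ⁻¹-involutive))

  module Span {d} (d-prime : Prime d) (d·1≡0 : d · 1# ≡ 0#) where
    instance
      d≢0 : NonZero d
      d≢0 = prime⇒nonZero d-prime

    d·x≡0 : ∀ x → d · x ≡ 0#
    d·x≡0 x = begin
      d · x           ≡⟨ cong (d ·_) (sym (*-identityˡ x)) ⟩
      d · (1# ⊛ x)    ≡⟨ sym (×-assoc-* d 1# x) ⟩
      (d · 1#) ⊛ x    ≡⟨ cong (_⊛ x) d·1≡0 ⟩
      0# ⊛ x          ≡⟨ zeroˡ x ⟩
      0#              ∎

    [a*d]·x≡0 : ∀ a x → (a * d) · x ≡ 0#
    [a*d]·x≡0 a x = trans (cong (_· x) (ℕ.*-comm a d)) (trans (sym (×-assocˡ x d a)) (d·x≡0 (a · x)))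

    [a%d]·x≡a·x : ∀ a x → (a % d) · x ≡ a · x
    [a%d]·x≡a·x a x = sym (begin
      a · x                               ≡⟨ cong (_· x) (ℕ.m≡m%n+[m/n]*n a d) ⟩
      (a % d + (a / d) * d) · x           ≡⟨ ×-homo-+ x (a % d) _ ⟩
      (a % d) · x ⊕ ((a / d) * d) · x     ≡⟨ cong ((a % d) · x ⊕_) ([a*d]·x≡0 (a / d) x) ⟩
      (a % d) · x ⊕ 0#                    ≡⟨ +-identityʳ _ ⟩
      (a % d) · x                         ∎)

    [d∸1]·x≡-x : ∀ x → (d ∸ 1) · x ≡ ⊝ x
    [d∸1]·x≡-x x = inverseʳ-unique x _ (trans (cong (_· x) (ℕ.suc-pred d)) (d·x≡0 x))

    -- A coefficient vector in F_d^j is encoded as an index in Fin (d ^ j), leading coefficient first.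
    leading : ∀ {j} → Fin (d ^ suc j) → Fin d
    leading {j} = Fin.quotient {d} (d ^ j)

    rest : ∀ {j} → Fin (d ^ suc j) → Fin (d ^ j)
    rest {j} = Fin.remainder {d} (d ^ j)

    combination : ∀ {j} → Vec (Fin n) j → Fin (d ^ j) → Fin n
    combination [] _ = 0#
    combination {suc j} (g ∷ gs) i = toℕ (leading {j} i) · g ⊕ combination gs (rest {j} i)

    combination-combine : ∀ {j} g (gs : Vec (Fin n) j) (c : Fin d) (r : Fin (d ^ j)) →
                          combination (g ∷ gs) (Fin.combine c r) ≡ toℕ c · g ⊕ combination gs r
    combination-combine g gs c r = cong (λ (c , r) → toℕ c · g ⊕ combination gs r) (Fin.remQuot-combine c r)

    zeroCoefficients : ∀ j → Fin (d ^ j)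
    zeroCoefficients zero = Fin.zero
    zeroCoefficients (suc j) = Fin.combine (0 ℕ.mod d) (zeroCoefficients j)

    addCoefficients : ∀ j → Fin (d ^ j) → Fin (d ^ j) → Fin (d ^ j)
    addCoefficients zero i _ = i
    addCoefficients (suc j) i i' =
      Fin.combine ((toℕ (leading {j} i) + toℕ (leading {j} i')) ℕ.mod d) (addCoefficients j (rest {j} i) (rest {j} i'))

    [a-mod-d]·x : ∀ a x → toℕ (a ℕ.mod d) · x ≡ a · x
    [a-mod-d]·x a x = trans (cong (_· x) (Fin.toℕ-fromℕ< (ℕ.m%n<n a d))) ([a%d]·x≡a·x a x)

    combination-zero : ∀ {j} (gs : Vec (Fin n) j) → combination gs (zeroCoefficients j) ≡ 0#
    combination-zero [] = refl
    combination-zero {suc j} (g ∷ gs) = begin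
      combination (g ∷ gs) (zeroCoefficients (suc j))            ≡⟨ combination-combine g gs _ _ ⟩
      toℕ (0 ℕ.mod d) · g ⊕ combination gs (zeroCoefficients j)  ≡⟨ cong₂ _⊕_ ([a-mod-d]·x 0 g) (combination-zero gs) ⟩
      0# ⊕ 0#                                                    ≡⟨ +-identityˡ 0# ⟩
      0#                                                         ∎

    combination-add : ∀ {j} (gs : Vec (Fin n) j) i i' →
                      combination gs (addCoefficients j i i') ≡ combination gs i ⊕ combination gs i'
    combination-add [] i i' = sym (+-identityˡ 0#)
    combination-add {suc j} (g ∷ gs) i i' = begin
      combination (g ∷ gs) (addCoefficients (suc j) i i')   ≡⟨ combination-combine g gs _ _ ⟩
      toℕ ((a + a') ℕ.mod d) · g ⊕ combination gs (addCoefficients j r r')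
        ≡⟨ cong₂ _⊕_ (trans ([a-mod-d]·x (a + a') g) (×-homo-+ g a a')) (combination-add gs r r') ⟩
      (a · g ⊕ a' · g) ⊕ (combination gs r ⊕ combination gs r')
        ≡⟨ interchange (a · g) (a' · g) _ _ ⟩
      (a · g ⊕ combination gs r) ⊕ (a' · g ⊕ combination gs r') ∎
      where
      a = toℕ (leading {j} i)
      a' = toℕ (leading {j} i')
      r = rest {j} i
      r' = rest {j} i'

    infix 4 _∈span_
    _∈span_ : ∀ {j} → Fin n → Vec (Fin n) j → Set
    x ∈span gs = ∃[ i ] combination gs i ≡ x

    0∈span : ∀ {j} (gs : Vec (Fin n) j) → 0# ∈span gs
    0∈span {j} gs = zeroCoefficients j , combination-zero gs

    +-∈span : ∀ {j} (gs : Vec (Fin n) j) {x y} → x ∈span gs → y ∈span gs → x ⊕ y ∈span gs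
    +-∈span {j} gs (i , refl) (i' , refl) = addCoefficients j i i' , combination-add gs i i'

    ·-∈span : ∀ {j} (gs : Vec (Fin n) j) t {x} → x ∈span gs → t · x ∈span gs
    ·-∈span gs zero _ = 0∈span gs
    ·-∈span gs (suc t) x∈ = +-∈span gs x∈ (·-∈span gs t x∈)

    -‿∈span : ∀ {j} (gs : Vec (Fin n) j) {x} → x ∈span gs → ⊝ x ∈span gs
    -‿∈span gs {x} x∈ = subst (_∈span gs) ([d∸1]·x≡-x x) (·-∈span gs (d ∸ 1) x∈)

    -- e is invertible modulo the prime d; the two Bézout cases give an inverse of e or of -e.
    ·-∈span⁻¹ : ∀ {j} (gs : Vec (Fin n) j) {e g} → .{{NonZero e}} → e < d → e · g ∈span gs → g ∈span gs
    ·-∈span⁻¹ gs {e} {g} e<d eg∈ with Coprimality.coprime-Bézout (Coprimality.prime⇒coprime d-prime e<d)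
    ... | Bézout.+- x y 1+ye≡xd = subst (_∈span gs) [d∸1]·[y·[e·g]]≡g (·-∈span gs (d ∸ 1) (·-∈span gs y eg∈))
      where
      [y*e]·g≡-g : (y * e) · g ≡ ⊝ g
      [y*e]·g≡-g = inverseʳ-unique g _ (begin
        g ⊕ (y * e) · g   ≡⟨ cong (_· g) 1+ye≡xd ⟩
        (x * d) · g       ≡⟨ [a*d]·x≡0 x g ⟩
        0#                ∎)
      [d∸1]·[y·[e·g]]≡g : (d ∸ 1) · (y · (e · g)) ≡ g
      [d∸1]·[y·[e·g]]≡g = begin
        (d ∸ 1) · (y · (e · g))   ≡⟨ cong ((d ∸ 1) ·_) (trans (×-assocˡ g y e) [y*e]·g≡-g) ⟩
        (d ∸ 1) · (⊝ g)           ≡⟨ [d∸1]·x≡-x (⊝ g) ⟩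
        ⊝ (⊝ g)                   ≡⟨ -‿involutive g ⟩
        g                         ∎
    ... | Bézout.-+ x y 1+xd≡ye = subst (_∈span gs) y·[e·g]≡g (·-∈span gs y eg∈)
      where
      y·[e·g]≡g : y · (e · g) ≡ g
      y·[e·g]≡g = begin
        y · (e · g)        ≡⟨ ×-assocˡ g y e ⟩
        (y * e) · g        ≡⟨ cong (_· g) (sym 1+xd≡ye) ⟩
        g ⊕ (x * d) · g    ≡⟨ cong (g ⊕_) ([a*d]·x≡0 x g) ⟩
        g ⊕ 0#             ≡⟨ +-identityʳ g ⟩
        g                  ∎

    distinct-leading⇒∈span : ∀ {j} (gs : Vec (Fin n) j) {g a a' s s'} → a < a' → a' < d →
                             s ∈span gs → s' ∈span gs → a · g ⊕ s ≡ a' · g ⊕ s' → g ∈span gs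
    distinct-leading⇒∈span gs {g} {a} {a'} {s} {s'} a<a' a'<d s∈ s'∈ a·g+s≡a'·g+s' =
      ·-∈span⁻¹ gs {{ℕ.>-nonZero (ℕ.m<n⇒0<n∸m a<a')}} (ℕ.≤-<-trans (ℕ.m∸n≤m a' a) a'<d)
        (subst (_∈span gs) (sym e·g≡s-s') (+-∈span gs s∈ (-‿∈span gs s'∈)))
      where
      e = a' ∸ a
      s≡e·g+s' : s ≡ e · g ⊕ s'
      s≡e·g+s' = ∙-cancelˡ (a · g) _ _ (begin
        a · g ⊕ s               ≡⟨ a·g+s≡a'·g+s' ⟩
        a' · g ⊕ s'             ≡⟨ cong (λ m → m · g ⊕ s') (sym (ℕ.m∸n+n≡m (ℕ.<⇒≤ a<a'))) ⟩
        (e + a) · g ⊕ s'        ≡⟨ cong (_⊕ s') (×-homo-+ g e a) ⟩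
        (e · g ⊕ a · g) ⊕ s'    ≡⟨ xy∙z≈y∙xz (e · g) (a · g) s' ⟩
        a · g ⊕ (e · g ⊕ s')    ∎)
      e·g≡s-s' : e · g ≡ s ⊕ ⊝ s'
      e·g≡s-s' = x≈z//y (e · g) s' s (sym s≡e·g+s')

    Independent : ∀ {j} → Vec (Fin n) j → Set
    Independent gs = Injective _≡_ _≡_ (combination gs)

    []-independent : Independent []
    []-independent {Fin.zero} {Fin.zero} _ = refl

    ∷-independent : ∀ {j} {gs : Vec (Fin n) j} {g} → Independent gs → ¬ g ∈span gs → Independent (g ∷ gs)
    ∷-independent {j} {gs} {g} gs-independent g∉span {i} {i'} same-combination
      with ℕ.<-cmp (toℕ (leading {j} i)) (toℕ (leading {j} i'))
    ... | tri< c<c' _ _ = contradiction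
      (distinct-leading⇒∈span gs c<c' (Fin.toℕ<n _) (_ , refl) (_ , refl) same-combination) g∉span
    ... | tri> _ _ c>c' = contradiction
      (distinct-leading⇒∈span gs c>c' (Fin.toℕ<n _) (_ , refl) (_ , refl) (sym same-combination)) g∉span
    ... | tri≈ _ c≡c' _ = begin
      i                                            ≡⟨ sym (Fin.combine-remQuot {d} (d ^ j) i) ⟩
      Fin.combine (leading {j} i) (rest {j} i)     ≡⟨ cong₂ Fin.combine (Fin.toℕ-injective c≡c') r≡r' ⟩
      Fin.combine (leading {j} i') (rest {j} i')   ≡⟨ Fin.combine-remQuot {d} (d ^ j) i' ⟩
      i'                                           ∎
      where
      r≡r' : rest {j} i ≡ rest {j} i'
      r≡r' = gs-independent (∙-cancelˡ _ _ _
        (trans same-combination (cong (λ c → c · g ⊕ combination gs (rest {j} i')) (sym c≡c'))))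

    basis-size : ∀ {m} {gs : Vec (Fin n) m} → Independent gs → (∀ x → x ∈span gs) → d ^ m ≡ n
    basis-size {gs = gs} independent spanning = ℕ.≤-antisym (Fin.injective⇒≤ independent) (Fin.injective⇒≤ coefficients-injective)
      where
      coefficients-injective : Injective _≡_ _≡_ (λ x → proj₁ (spanning x))
      coefficients-injective {x} {y} same = trans (sym (proj₂ (spanning x))) (trans (cong (combination gs) same) (proj₂ (spanning y)))

    _∈span?_ : ∀ {j} x (gs : Vec (Fin n) j) → Dec (x ∈span gs)
    x ∈span? gs = Fin.any? (λ i → combination gs i Fin.≟ x)

    Basis : Set
    Basis = ∃[ m ] Σ (Vec (Fin n) m) λ gs → Independent gs × (∀ x → x ∈span gs)

    -- Each step adds a vector outside the span; since j < d ^ j ≤ n for independent gs, n + 1 steps suffice.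
    extend-to-basis : ∀ fuel {j} (gs : Vec (Fin n) j) → Independent gs → n < j + fuel → Basis
    extend-to-basis fuel gs independent _ with Fin.all? (_∈span? gs)
    ... | yes spanning = _ , gs , independent , spanning
    extend-to-basis zero {j} gs independent n<j+0 | no _ =
      contradiction (ℕ.<-≤-trans (ℕ.<-trans (subst (n <_) (ℕ.+-identityʳ j) n<j+0) (n<m^n (prime⇒1<p d-prime) j))
                                 (Fin.injective⇒≤ independent))
                    (ℕ.<-irrefl refl)
    extend-to-basis (suc fuel) {j} gs independent n<j+1+fuel | no ¬spanning
      with Fin.¬∀⟶∃¬ n _ (_∈span? gs) ¬spanning
    ... | x , x∉span = extend-to-basis fuel (x ∷ gs) (∷-independent {gs = gs} independent x∉span) (subst (n <_) (ℕ.+-suc j fuel) n<j+1+fuel)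

    basis : Basis
    basis = extend-to-basis (suc n) [] []-independent (ℕ.n<1+n n)

    module Coordinates {m} (gs : Vec (Fin n) (suc m)) (independent : Independent gs) (spanning : ∀ x → x ∈span gs) where
      coefficients : Fin n → Fin (d ^ suc m)
      coefficients x = proj₁ (spanning x)

      combination-coefficients : ∀ x → combination gs (coefficients x) ≡ x
      combination-coefficients x = proj₂ (spanning x)

      coefficients-combination : ∀ i → coefficients (combination gs i) ≡ i
      coefficients-combination i = independent (combination-coefficients (combination gs i))

      coordinate : Fin n → ℕ
      coordinate x = toℕ (leading {m} (coefficients x))

      coordinate-combination : ∀ i → coordinate (combination gs i) ≡ toℕ (leading {m} i)
      coordinate-combination i = cong (toℕ ∘ leading {m}) (coefficients-combination i)

      leading-combine : ∀ c r → leading {m} (Fin.combine c r) ≡ c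
      leading-combine c r = cong proj₁ (Fin.remQuot-combine c r)

      coordinate-0 : coordinate 0# ≡ 0
      coordinate-0 = begin
        coordinate 0#                                             ≡⟨ cong coordinate (sym (combination-zero gs)) ⟩
        coordinate (combination gs (zeroCoefficients (suc m)))    ≡⟨ coordinate-combination _ ⟩
        toℕ (leading {m} (zeroCoefficients (suc m)))              ≡⟨ cong toℕ (leading-combine _ _) ⟩
        toℕ (0 ℕ.mod d)                                           ≡⟨ Fin.toℕ-fromℕ< (ℕ.m%n<n 0 d) ⟩
        0 % d                                                     ≡⟨ ℕ.m<n⇒m%n≡m (ℕ.>-nonZero⁻¹ d) ⟩
        0                                                         ∎

      coordinate-+ : ∀ x y → coordinate (x ⊕ y) ≡ (coordinate x + coordinate y) % d
      coordinate-+ x y = begin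
        coordinate (x ⊕ y)
          ≡⟨ cong coordinate (sym (trans (combination-add gs _ _) (cong₂ _⊕_ (combination-coefficients x) (combination-coefficients y)))) ⟩
        coordinate (combination gs (addCoefficients (suc m) (coefficients x) (coefficients y)))
          ≡⟨ coordinate-combination _ ⟩
        toℕ (leading {m} (addCoefficients (suc m) (coefficients x) (coefficients y)))
          ≡⟨ cong toℕ (leading-combine _ _) ⟩
        toℕ ((coordinate x + coordinate y) ℕ.mod d)
          ≡⟨ Fin.toℕ-fromℕ< (ℕ.m%n<n _ d) ⟩
        (coordinate x + coordinate y) % d ∎

      -- combination gs is a bijection Fin (d * d ^ m) → F under which coordinate becomes leading.
      sum-∘coordinate : ∀ (f : ℕ → ℕ) → sum (λ x → f (coordinate x)) ≡ d ^ m * sum {d} (λ c → f (toℕ c))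
      sum-∘coordinate f = begin
        sum (λ x → f (coordinate x))
          ≡⟨ sum-permute _ (permutation (combination gs) coefficients combination-coefficients coefficients-combination) ⟩
        sum (λ i → f (coordinate (combination gs i)))
          ≡⟨ sum-cong-≗ (cong f ∘ coordinate-combination) ⟩
        sum (λ i → f (toℕ (leading {m} i)))
          ≡⟨ sum-combine d (d ^ m) _ ⟩
        sum {d} (λ c → sum {d ^ m} (λ r → f (toℕ (leading {m} (Fin.combine c r)))))
          ≡⟨ sum-cong-≗ (λ c → trans (sum-cong-≗ (λ r → cong (f ∘ toℕ) (leading-combine c r))) (sum-const (d ^ m) _)) ⟩
        sum {d} (λ c → d ^ m * f (toℕ c))
          ≡⟨ sym (*-distribˡ-sum {d} (d ^ m) (λ c → f (toℕ c))) ⟩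
        d ^ m * sum {d} (λ c → f (toℕ c)) ∎

      coordinate-+³ : ∀ x y z → coordinate (x ⊕ y ⊕ z) ≡ (coordinate x + coordinate y + coordinate z) % d
      coordinate-+³ x y z = begin
        coordinate (x ⊕ y ⊕ z)                               ≡⟨ coordinate-+ (x ⊕ y) z ⟩
        (coordinate (x ⊕ y) + coordinate z) % d              ≡⟨ cong (λ c → (c + coordinate z) % d) (coordinate-+ x y) ⟩
        ((coordinate x + coordinate y) % d + coordinate z) % d  ≡⟨ [m%d+n]%d≡[m+n]%d (coordinate x + coordinate y) (coordinate z) d ⟩
        (coordinate x + coordinate y + coordinate z) % d     ∎

      module _ {S : ℕ → Set} (S? : U.Decidable S) where
        Λ : Subset n
        Λ = tabulate (λ x → does (S? (coordinate (x ⁻¹))))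

        ∈Λ⇒ : ∀ {x} → x ∈ Λ → S (coordinate (x ⁻¹))
        ∈Λ⇒ {x} x∈Λ =
          invert (subst (Reflects _) (trans (sym (Vec.lookup∘tabulate _ x)) (Vec.[]=⇒lookup x∈Λ)) (proof (S? (coordinate (x ⁻¹)))))

        Λ-nonZero : ¬ S 0 → NonZeroSubset F Λ
        Λ-nonZero 0∉S x x∈Λ refl = 0∉S (subst S (trans (cong coordinate 0⁻¹≡0) coordinate-0) (∈Λ⇒ x∈Λ))

        Λ-good : ¬ S 0 → ThreeSumFree d S → Good F Λ
        Λ-good 0∉S sum-free a b c a∈Λ b∈Λ c∈Λ ab+bc+ac≡0 =
          sum-free (∈Λ⇒ c∈Λ) (∈Λ⇒ a∈Λ) (∈Λ⇒ b∈Λ) (begin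
            (coordinate (c ⁻¹) + coordinate (a ⁻¹) + coordinate (b ⁻¹)) % d  ≡⟨ coordinate-+³ _ _ _ ⟨
            coordinate (c ⁻¹ ⊕ a ⁻¹ ⊕ b ⁻¹)                                 ≡⟨ cong coordinate reciprocals-sum-to-0 ⟩
            coordinate 0#                                                   ≡⟨ coordinate-0 ⟩
            0                                                               ∎)
          where
          invertible : ∀ {x} → x ∈ Λ → x ⊛ x ⁻¹ ≡ 1#
          invertible {x} x∈Λ = x*x⁻¹≡1 (Λ-nonZero 0∉S x x∈Λ)
          reciprocals-sum-to-0 : c ⁻¹ ⊕ a ⁻¹ ⊕ b ⁻¹ ≡ 0#
          reciprocals-sum-to-0 = begin
            c ⁻¹ ⊕ a ⁻¹ ⊕ b ⁻¹                                     ≡⟨ reciprocal-sum (commutativeRing F) (invertible a∈Λ) (invertible b∈Λ) (invertible c∈Λ) ⟨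
            ((a ⊛ b) ⊕ (b ⊛ c) ⊕ (a ⊛ c)) ⊛ ((a ⁻¹ ⊛ b ⁻¹) ⊛ c ⁻¹)  ≡⟨ cong (_⊛ ((a ⁻¹ ⊛ b ⁻¹) ⊛ c ⁻¹)) ab+bc+ac≡0 ⟩
            0# ⊛ ((a ⁻¹ ⊛ b ⁻¹) ⊛ c ⁻¹)                            ≡⟨ zeroˡ _ ⟩
            0#                                                     ∎

        ∣Λ∣≡ : ∣ Λ ∣ ≡ d ^ m * countBelow S? d
        ∣Λ∣≡ = begin
          ∣ Λ ∣                                                  ≡⟨ ∣tabulate∣≡sum (λ x → does (S? (coordinate (x ⁻¹)))) ⟩
          sum (λ x → indicator (does (S? (coordinate (x ⁻¹)))))  ≡⟨ sum-∘⁻¹ (λ x → indicator (does (S? (coordinate x)))) ⟩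
          sum (λ x → indicator (does (S? (coordinate x))))       ≡⟨ sum-∘coordinate (λ c → indicator (does (S? c))) ⟩
          d ^ m * countBelow S? d                                ∎

        good-set : ¬ S 0 → ThreeSumFree d S →
                   Σ (Subset n) λ Λ → NonZeroSubset F Λ × Good F Λ × ∣ Λ ∣ ≡ d ^ m * countBelow S? d
        good-set 0∉S sum-free = Λ , Λ-nonZero 0∉S , Λ-good 0∉S sum-free , ∣Λ∣≡

theorem5 : (p h k : ℕ) → Prime p → ¬ (2 ∣ p) → p ≢ 3 → 1 ≤ h →
           1 ≤ k → (p ≡ 3 * k + 1 ⊎ p + 1 ≡ 3 * k) →
           (F : FieldOn (p ^ h)) →
           Σ (Subset (p ^ h)) (λ Λ →
             NonZeroSubset F Λ × Good F Λ × ∣ Λ ∣ ≡ k * p ^ (h ∸ 1))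
theorem5 p (suc h) k p-prime _ _ 1≤h 1≤k p≡3k±1 F
  with d , d-prime , d·1≡0 ← FiniteField.primeCharacteristic F
  with m , gs , independent , spanning ← FiniteField.Span.basis F d-prime d·1≡0
  with refl , refl ← prime-power-unique {m = m} d-prime p-prime 1≤h (FiniteField.Span.basis-size F d-prime d·1≡0 {gs = gs} independent spanning)
  with S , S? , 0∉S , sum-free , ∣S∣≡k ← threeSumFree-residues {{prime⇒nonZero p-prime}} 1≤k p≡3k±1
  with Λ , Λ-nonZero , Λ-good , ∣Λ∣≡ ← FiniteField.Span.Coordinates.good-set F d-prime d·1≡0 gs independent spanning S? 0∉S sum-free
  = Λ , Λ-nonZero , Λ-good , trans ∣Λ∣≡ (trans (cong (p ^ h *_) ∣S∣≡k) (ℕ.*-comm (p ^ h) k))
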